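{- Let $P=(C,A^\oplus,A^\ominus)$ be a binary pattern graph and $\bar P=(C,A^\ominus,A^\oplus)$. Then $\mathrm{p\text{ - }saturation}^{\ge}(P)\in\mathrm{para\text{ - }AC}^0$ if and only if $\mathrm{p\text{ - }saturation}^{\ge}(\bar P)\in\mathrm{para\text{ - }AC}^0$.
   Context: A basic graph $B=(V,E)$ is a finite undirected graph without self-loops. A binary pattern graph is $P=(C,A^\oplus,A^\ominus)$ with $C=\{\mathrm{black},\mathrm{white}\}$ and $A^\oplus,A^\ominus\subseteq C\times C$. For a coloring $c\colon V\to C$, a witness function is $w\colon V\to V$ with, for all $x$: $x\ne w(x)$; $\{x,w(x)\}\in E\Rightarrow(c(x),c(w(x)))\in A^\oplus$; $\{x,w(x)\}\notin E\Rightarrow(c(x),c(w(x)))\in A^\ominus$. $B$ is $P$-saturated by $c,w$ if $w$ is a witness function for $c$; the weight of $c$ is its number of black vertices. $\mathrm{p\text{ - }saturation}^{\ge}(P)$: given a basic graph $B$ and $k$ (parameter $k$), decide whether $B$ can be $P$-saturated via a coloring of weight at least $k$. $\mathrm{para\text{ - }AC}^0$: parameterized problems decided by constant-depth unbounded fan-in circuit families of size $f(k)n^{O(1)}$, $f$ computable. -}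

module Defs where

open import Data.Bool using (Bool; true; false; if_then_else_)
open import Data.Nat using (ℕ; zero; suc; _+_; _*_; _^_; _≤_; _⊔_)
open import Data.Fin using (Fin)
open import Data.List using (List; []; _∷_)
open import Data.Product using (Σ; _×_; ∃)
open import Relation.Binary.PropositionalEquality using (_≡_; _≢_)
open import Function.Bundles using (_⇔_)

Color : Set
Color = Bool

black white : Color
black = true
white = false

record PatternGraph : Set where
  constructor mkPattern
  field
    A⊕ : Color → Color → Bool
    A⊖ : Color → Color → Bool
open PatternGraph public

complementPattern : PatternGraph → PatternGraph
complementPattern P = mkPattern (A⊖ P) (A⊕ P)

record BasicGraph (n : ℕ) : Set where
  field
    adj   : Fin n → Fin n → Bool
    sym   : ∀ x y → adj x y ≡ adj y x
    irref : ∀ x → adj x x ≡ false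
open BasicGraph public

IsWitness : ∀ {n} → PatternGraph → BasicGraph n → (Fin n → Color) → (Fin n → Fin n) → Set
IsWitness P B c w = ∀ x →
    (x ≢ w x)
  × (adj B x (w x) ≡ true  → A⊕ P (c x) (c (w x)) ≡ true)
  × (adj B x (w x) ≡ false → A⊖ P (c x) (c (w x)) ≡ true)

weight : ∀ {n} → (Fin n → Color) → ℕ
weight {zero}  c = 0
weight {suc n} c = (if c Fin.zero then 1 else 0) + weight (λ x → c (Fin.suc x))

SaturationGE : PatternGraph → (n : ℕ) → BasicGraph n → ℕ → Set
SaturationGE P n B k =
  Σ (Fin n → Color) λ c → Σ (Fin n → Fin n) λ w → IsWitness P B c w × (k ≤ weight c)

data Circuit (V : Set) : Set where
  input : V → Circuit V
  not   : Circuit V → Circuit V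
  and   : List (Circuit V) → Circuit V
  or    : List (Circuit V) → Circuit V

mutual
  eval : ∀ {V} → (V → Bool) → Circuit V → Bool
  eval ρ (input v) = ρ v
  eval ρ (not g)   = if eval ρ g then false else true
  eval ρ (and gs)  = evalAnd ρ gs
  eval ρ (or gs)   = evalOr ρ gs

  evalAnd : ∀ {V} → (V → Bool) → List (Circuit V) → Bool
  evalAnd ρ []       = true
  evalAnd ρ (g ∷ gs) = if eval ρ g then evalAnd ρ gs else false

  evalOr : ∀ {V} → (V → Bool) → List (Circuit V) → Bool
  evalOr ρ []       = false
  evalOr ρ (g ∷ gs) = if eval ρ g then true else evalOr ρ gs

mutual
  size : ∀ {V} → Circuit V → ℕ
  size (input v) = 1
  size (not g)   = suc (size g)
  size (and gs)  = suc (sizes gs)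
  size (or gs)   = suc (sizes gs)

  sizes : ∀ {V} → List (Circuit V) → ℕ
  sizes []       = 0
  sizes (g ∷ gs) = size g + sizes gs

mutual
  depth : ∀ {V} → Circuit V → ℕ
  depth (input v) = 0
  depth (not g)   = suc (depth g)
  depth (and gs)  = suc (depths gs)
  depth (or gs)   = suc (depths gs)

  depths : ∀ {V} → List (Circuit V) → ℕ
  depths []       = 0
  depths (g ∷ gs) = depth g ⊔ depths gs

-- Parameterized problems on basic graphs with parameter k, and para-AC⁰.
-- An instance (B, k) with B on n vertices is fed to the circuit C n k
-- whose inputs are the n² adjacency bits of B.

GraphProblem : Set₁
GraphProblem = (n : ℕ) → BasicGraph n → ℕ → Set

InParaAC0 : GraphProblem → Set
InParaAC0 Q =
  Σ (ℕ → ℕ) λ f →              -- computable (every Agda function is)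
  Σ ℕ λ d →
  Σ ℕ λ e →
  Σ ((n k : ℕ) → Circuit (Fin n × Fin n)) λ C →
    ∀ n k →
        (depth (C n k) ≤ d)
      × (size (C n k) ≤ f k * (suc n) ^ e)
      × (∀ (B : BasicGraph n) →
           (eval (λ p → adj B (Data.Product.proj₁ p) (Data.Product.proj₂ p)) (C n k) ≡ true)
             ⇔ Q n B k)

-- Complementing the basic graph swaps the roles of A⊕ and A⊖: (B, k) is a
-- yes-instance for P̄ exactly when (B̄, k) is one for P, where B̄ is the
-- complement of B. Each adjacency bit of B̄ is the negation of the
-- corresponding bit of B (or the constant false on the diagonal), so a
-- circuit family for P becomes one for P̄ by substituting these tiny circuits
-- for its inputs, at the cost of one extra layer and a doubling of size.
-- Since P̄̄ = P, the same argument gives the converse.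
module Submission where

open import Defs
open import Data.Bool using (Bool; true; false; if_then_else_) renaming (not to notᵇ)
open import Data.Nat using (ℕ; suc; _+_; _*_; _^_; _≤_; z≤n; s≤s)
open import Data.Nat.Properties
  using (≤-refl; ≤-trans; ≤-reflexive; +-monoˡ-≤; +-mono-≤; *-monoˡ-≤; m≤n+m;
         m≤m⊔n; m≤n⊔m; ⊔-lub; *-identityˡ; *-distribʳ-+; *-commutativeSemigroup)
open import Data.Fin using (Fin; _≟_)
open import Data.List using (List; []; _∷_)
open import Data.Product using (_×_; _,_; proj₁; proj₂)
open import Relation.Nullary using (yes; no; contradiction)
open import Relation.Binary.PropositionalEquality
  using (_≡_; _≢_; refl; cong; cong₂; ≢-sym)
  renaming (sym to ≡-sym; subst to ≡-subst)
open import Function.Bundles using (_⇔_; mk⇔)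
open import Function.Properties.Equivalence using () renaming (sym to ⇔-sym; trans to ⇔-trans)
open import Algebra.Properties.CommutativeSemigroup *-commutativeSemigroup using (xy∙z≈xz∙y)

complementAdj : ∀ {n} → BasicGraph n → Fin n → Fin n → Bool
complementAdj B x y with x ≟ y
... | yes _ = false
... | no  _ = notᵇ (adj B x y)

complementAdj-sym : ∀ {n} (B : BasicGraph n) x y → complementAdj B x y ≡ complementAdj B y x
complementAdj-sym B x y with x ≟ y | y ≟ x
... | yes _   | yes _   = refl
... | yes x≡y | no  y≢x = contradiction (≡-sym x≡y) y≢x
... | no  x≢y | yes y≡x = contradiction (≡-sym y≡x) x≢y
... | no  _   | no  _   = cong notᵇ (BasicGraph.sym B x y)

complementAdj-irrefl : ∀ {n} (B : BasicGraph n) x → complementAdj B x x ≡ false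
complementAdj-irrefl B x with x ≟ x
... | yes _   = refl
... | no  x≢x = contradiction refl x≢x

complement : ∀ {n} → BasicGraph n → BasicGraph n
complement B = record
  { adj = complementAdj B ; sym = complementAdj-sym B ; irref = complementAdj-irrefl B }

notᵇ-≢ : ∀ b → notᵇ b ≢ b
notᵇ-≢ true  ()
notᵇ-≢ false ()

complement-adj-≢ : ∀ {n} (B : BasicGraph n) {x y} → x ≢ y → adj (complement B) x y ≢ adj B x y
complement-adj-≢ B {x} {y} x≢y with x ≟ y
... | yes x≡y = contradiction x≡y x≢y
... | no  _   = notᵇ-≢ (adj B x y)

-- The condition IsWitness imposes on a vertex whose edge bit to its witness is b.
EdgeCondition : Bool → Set → Set → Set
EdgeCondition b p q = (b ≡ true → p) × (b ≡ false → q)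

swapEdgeCondition : ∀ {b b′ p q} → b ≢ b′ → EdgeCondition b p q → EdgeCondition b′ q p
swapEdgeCondition {true}  {true}  b≢b′ _       = contradiction refl b≢b′
swapEdgeCondition {true}  {false} _    (p , _) = (λ ()) , (λ _ → p refl)
swapEdgeCondition {false} {true}  _    (_ , q) = (λ _ → q refl) , (λ ())
swapEdgeCondition {false} {false} b≢b′ _       = contradiction refl b≢b′

module _ (P : PatternGraph) {n} (B : BasicGraph n) {c : Fin n → Color} {w : Fin n → Fin n} where

  isWitness-complement⁺ : IsWitness P (complement B) c w → IsWitness (complementPattern P) B c w
  isWitness-complement⁺ W x =
    let (x≢wx , condition) = W x in
    x≢wx , swapEdgeCondition (complement-adj-≢ B x≢wx) condition

  isWitness-complement⁻ : IsWitness (complementPattern P) B c w → IsWitness P (complement B) c w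
  isWitness-complement⁻ W x =
    let (x≢wx , condition) = W x in
    x≢wx , swapEdgeCondition (≢-sym (complement-adj-≢ B x≢wx)) condition

saturationGE-complement : ∀ P n (B : BasicGraph n) k →
  SaturationGE (complementPattern P) n B k ⇔ SaturationGE P n (complement B) k
saturationGE-complement P n B k = mk⇔
  (λ (c , w , W , k≤weight) → c , w , isWitness-complement⁻ P B W , k≤weight)
  (λ (c , w , W , k≤weight) → c , w , isWitness-complement⁺ P B W , k≤weight)

mutual
  substitute : ∀ {V W : Set} → (V → Circuit W) → Circuit V → Circuit W
  substitute σ (input v) = σ v
  substitute σ (not g)   = not (substitute σ g)
  substitute σ (and gs)  = and (substituteAll σ gs)
  substitute σ (or gs)   = or (substituteAll σ gs)

  substituteAll : ∀ {V W : Set} → (V → Circuit W) → List (Circuit V) → List (Circuit W)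
  substituteAll σ []       = []
  substituteAll σ (g ∷ gs) = substitute σ g ∷ substituteAll σ gs

module _ {V W : Set} (σ : V → Circuit W) where

  module _ {ρ : W → Bool} {ρ′ : V → Bool} (σ-correct : ∀ v → eval ρ (σ v) ≡ ρ′ v) where
    mutual
      eval-substitute : ∀ g → eval ρ (substitute σ g) ≡ eval ρ′ g
      eval-substitute (input v) = σ-correct v
      eval-substitute (not g)   = cong (λ b → if b then false else true) (eval-substitute g)
      eval-substitute (and gs)  = evalAnd-substituteAll gs
      eval-substitute (or gs)   = evalOr-substituteAll gs

      evalAnd-substituteAll : ∀ gs → evalAnd ρ (substituteAll σ gs) ≡ evalAnd ρ′ gs
      evalAnd-substituteAll []       = refl
      evalAnd-substituteAll (g ∷ gs) =
        cong₂ (λ a b → if a then b else false) (eval-substitute g) (evalAnd-substituteAll gs)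

      evalOr-substituteAll : ∀ gs → evalOr ρ (substituteAll σ gs) ≡ evalOr ρ′ gs
      evalOr-substituteAll []       = refl
      evalOr-substituteAll (g ∷ gs) =
        cong₂ (λ a b → if a then true else b) (eval-substitute g) (evalOr-substituteAll gs)

  module _ {d : ℕ} (σ-depth : ∀ v → depth (σ v) ≤ d) where
    mutual
      depth-substitute : ∀ g → depth (substitute σ g) ≤ depth g + d
      depth-substitute (input v) = σ-depth v
      depth-substitute (not g)   = s≤s (depth-substitute g)
      depth-substitute (and gs)  = s≤s (depths-substituteAll gs)
      depth-substitute (or gs)   = s≤s (depths-substituteAll gs)

      depths-substituteAll : ∀ gs → depths (substituteAll σ gs) ≤ depths gs + d
      depths-substituteAll []       = z≤n
      depths-substituteAll (g ∷ gs) = ⊔-lub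
        (≤-trans (depth-substitute g) (+-monoˡ-≤ d (m≤m⊔n (depth g) (depths gs))))
        (≤-trans (depths-substituteAll gs) (+-monoˡ-≤ d (m≤n⊔m (depth g) (depths gs))))

  -- The bound is stated for suc s so that every gate of g also fits into its share.
  module _ {s : ℕ} (σ-size : ∀ v → size (σ v) ≤ suc s) where
    mutual
      size-substitute : ∀ g → size (substitute σ g) ≤ size g * suc s
      size-substitute (input v) = ≤-trans (σ-size v) (≤-reflexive (≡-sym (*-identityˡ (suc s))))
      size-substitute (not g)    = s≤s (≤-trans (size-substitute g) (m≤n+m _ s))
      size-substitute (and gs)   = s≤s (≤-trans (sizes-substituteAll gs) (m≤n+m _ s))
      size-substitute (or gs)    = s≤s (≤-trans (sizes-substituteAll gs) (m≤n+m _ s))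

      sizes-substituteAll : ∀ gs → sizes (substituteAll σ gs) ≤ sizes gs * suc s
      sizes-substituteAll []       = z≤n
      sizes-substituteAll (g ∷ gs) =
        ≤-trans (+-mono-≤ (size-substitute g) (sizes-substituteAll gs))
                (≤-reflexive (≡-sym (*-distribʳ-+ (suc s) (size g) (sizes gs))))

adjacencyBits : ∀ {n} → BasicGraph n → Fin n × Fin n → Bool
adjacencyBits B p = adj B (proj₁ p) (proj₂ p)

inParaAC0-reduction : ∀ {Q R : GraphProblem} (T : ∀ {n} → BasicGraph n → BasicGraph n)
  (σ : ∀ {n} → Fin n × Fin n → Circuit (Fin n × Fin n)) {d s : ℕ} →
  (∀ {n} (v : Fin n × Fin n) → depth (σ v) ≤ d) →
  (∀ {n} (v : Fin n × Fin n) → size (σ v) ≤ suc s) →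
  (∀ {n} (B : BasicGraph n) v → eval (adjacencyBits B) (σ v) ≡ adjacencyBits (T B) v) →
  (∀ n B k → Q n B k ⇔ R n (T B) k) →
  InParaAC0 R → InParaAC0 Q
inParaAC0-reduction {R = R} T σ {d} {s} σ-depth σ-size σ-computes-T Q⇔R (f , d₀ , e , C , C-decides) =
  (λ k → f k * suc s) , d₀ + d , e , (λ n k → substitute σ (C n k)) , λ n k →
    let (C-depth , C-size , C-correct) = C-decides n k in
      ≤-trans (depth-substitute σ σ-depth (C n k)) (+-monoˡ-≤ d C-depth)
    , ≤-trans (size-substitute σ σ-size (C n k))
        (≤-trans (*-monoˡ-≤ (suc s) C-size) (≤-reflexive (xy∙z≈xz∙y (f k) (suc n ^ e) (suc s))))
    , λ B → ⇔-trans
        (≡-subst (λ b → b ≡ true ⇔ R n (T B) k)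
                 (≡-sym (eval-substitute σ (σ-computes-T B) (C n k)))
                 (C-correct (T B)))
        (⇔-sym (Q⇔R n B k))

complementBit : ∀ {n} → Fin n × Fin n → Circuit (Fin n × Fin n)
complementBit (x , y) with x ≟ y
... | yes _ = or []
... | no  _ = not (input (x , y))

complementBit-depth : ∀ {n} (v : Fin n × Fin n) → depth (complementBit v) ≤ 1
complementBit-depth (x , y) with x ≟ y
... | yes _ = ≤-refl
... | no  _ = ≤-refl

complementBit-size : ∀ {n} (v : Fin n × Fin n) → size (complementBit v) ≤ 2
complementBit-size (x , y) with x ≟ y
... | yes _ = s≤s z≤n
... | no  _ = ≤-refl

eval-complementBit : ∀ {n} (B : BasicGraph n) v →
  eval (adjacencyBits B) (complementBit v) ≡ adjacencyBits (complement B) v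
eval-complementBit B (x , y) with x ≟ y
... | yes _ = refl
... | no  _ = if-then-false-else-true (adj B x y)
  where
  if-then-false-else-true : ∀ b → (if b then false else true) ≡ notᵇ b
  if-then-false-else-true true  = refl
  if-then-false-else-true false = refl

inParaAC0-complementPattern : ∀ P →
  InParaAC0 (SaturationGE P) → InParaAC0 (SaturationGE (complementPattern P))
inParaAC0-complementPattern P = inParaAC0-reduction complement complementBit
  complementBit-depth complementBit-size eval-complementBit (saturationGE-complement P)

mainTheorem15 : (P : PatternGraph) →
    (InParaAC0 (SaturationGE P) → InParaAC0 (SaturationGE (complementPattern P)))
    × (InParaAC0 (SaturationGE (complementPattern P)) → InParaAC0 (SaturationGE P))
mainTheorem15 P = inParaAC0-complementPattern P , inParaAC0-complementPattern (complementPattern P)
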